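{- For every nonnegative integer $n$, $$2\sum_{\substack{i+j+k=n\\ i,j,k\ge 0}} C_{2i}\,C_{2j}\,B_{2k}=B_{2n+1}.$$
   Context: For a nonnegative integer $m$, $C_m=\frac{1}{m+1}\binom{2m}{m}$ is the $m$th Catalan number and $B_m=\binom{2m}{m}$ is the $m$th central binomial coefficient. -}

module Defs where

open import Data.Nat using (ℕ; zero; suc; _+_; _*_; _∸_; _/_)
open import Data.Nat.Combinatorics using (_C_)

B : ℕ → ℕ
B m = (2 * m) C m

-- Catalan number C m = binom(2m, m) / (m + 1)  (exact division)
Cat : ℕ → ℕ
Cat m = B m / suc m

sumTo : ℕ → (ℕ → ℕ) → ℕ
sumTo zero    f = f zero
sumTo (suc n) f = sumTo n f + f (suc n)

tripleSum : ℕ → ℕ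
tripleSum n = sumTo n (λ i → sumTo (n ∸ i) (λ j →
  Cat (2 * i) * Cat (2 * j) * B (2 * (n ∸ i ∸ j))))

-- Write y = x² and split the generating functions of the Catalan and central
-- binomial numbers by parity: c(x) = p(y) + x r(y), b(x) = q(y) + x o(y).
-- The even part of c = 1 + x c² and the odd part of b = 1 + 2x c b read
--   p = 1 + 2y r p   and   o = 2 p q + 2y r o,
-- so o and 2p²q both solve t = 2pq + 2y r t, whose solution is unique; the sum
-- in the theorem is the coefficient of yⁿ in p²q. The two quadratic relations
-- for c and b both come from one convolution identity for ballot numbers.
module Submission where

open import Data.Nat using (ℕ; zero; suc; _+_; _*_; _∸_; _≤_; z≤n; s≤s; _/_)
open import Data.Nat.Properties
open import Algebra.Properties.CommutativeSemigroup +-commutativeSemigroup using () renaming (interchange to +-interchange)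
open import Data.Nat.Combinatorics using (_C_; nCk+nC[k+1]≡[n+1]C[k+1]; nCk≡nC[n∸k]; nC1≡n; k>n⇒nCk≡0)
open import Data.Nat.DivMod using (m*n/n≡m)
open import Data.Nat.Tactic.RingSolver using (solve-∀)
open import Relation.Binary.PropositionalEquality
open ≡-Reasoning

open import Defs

sumTo-cong : ∀ n {f g : ℕ → ℕ} → (∀ i → i ≤ n → f i ≡ g i) → sumTo n f ≡ sumTo n g
sumTo-cong zero    f≗g = f≗g 0 z≤n
sumTo-cong (suc n) f≗g =
  cong₂ _+_ (sumTo-cong n (λ i i≤n → f≗g i (m≤n⇒m≤1+n i≤n))) (f≗g (suc n) ≤-refl)

sumTo-+ : ∀ n (f g : ℕ → ℕ) → sumTo n (λ i → f i + g i) ≡ sumTo n f + sumTo n g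
sumTo-+ zero    f g = refl
sumTo-+ (suc n) f g = trans (cong (_+ (f (suc n) + g (suc n))) (sumTo-+ n f g))
  (+-interchange (sumTo n f) (sumTo n g) (f (suc n)) (g (suc n)))

sumTo-* : ∀ n c (f : ℕ → ℕ) → sumTo n (λ i → c * f i) ≡ c * sumTo n f
sumTo-* zero    c f = refl
sumTo-* (suc n) c f = trans (cong (_+ c * f (suc n)) (sumTo-* n c f))
  (sym (*-distribˡ-+ c (sumTo n f) (f (suc n))))

sumTo-unfoldˡ : ∀ n (f : ℕ → ℕ) → sumTo (suc n) f ≡ f 0 + sumTo n (λ i → f (suc i))
sumTo-unfoldˡ zero    f = refl
sumTo-unfoldˡ (suc n) f = trans (cong (_+ f (suc (suc n))) (sumTo-unfoldˡ n f))
  (+-assoc (f 0) (sumTo n (λ i → f (suc i))) (f (suc (suc n))))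

sumTo-reverse : ∀ n (f : ℕ → ℕ) → sumTo n f ≡ sumTo n (λ i → f (n ∸ i))
sumTo-reverse zero    f = refl
sumTo-reverse (suc n) f = begin
  sumTo (suc n) f                          ≡⟨ sumTo-unfoldˡ n f ⟩
  f 0 + sumTo n (λ i → f (suc i))          ≡⟨ cong (f 0 +_) (sumTo-reverse n (λ i → f (suc i))) ⟩
  f 0 + sumTo n (λ i → f (suc (n ∸ i)))
    ≡⟨ cong (f 0 +_) (sumTo-cong n (λ i i≤n → cong f (sym (+-∸-assoc 1 i≤n)))) ⟩
  f 0 + sumTo n (λ i → f (suc n ∸ i))      ≡⟨ +-comm (f 0) _ ⟩
  sumTo n (λ i → f (suc n ∸ i)) + f 0
    ≡⟨ cong (λ k → sumTo n (λ i → f (suc n ∸ i)) + f k) (n∸n≡0 n) ⟨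
  sumTo (suc n) (λ i → f (suc n ∸ i))      ∎

sumTo-exchange : ∀ n (f : ℕ → ℕ → ℕ) →
  sumTo n (λ k → sumTo k (λ i → f i k)) ≡ sumTo n (λ i → sumTo (n ∸ i) (λ j → f i (i + j)))
sumTo-exchange zero    f = refl
sumTo-exchange (suc n) f = begin
  sumTo n (λ k → sumTo k (λ i → f i k)) + (sumTo n (λ i → f i (suc n)) + f (suc n) (suc n))
    ≡⟨ cong (_+ (sumTo n (λ i → f i (suc n)) + f (suc n) (suc n))) (sumTo-exchange n f) ⟩
  inner n + (sumTo n (λ i → f i (suc n)) + f (suc n) (suc n))
    ≡⟨ +-assoc (inner n) _ _ ⟨
  inner n + sumTo n (λ i → f i (suc n)) + f (suc n) (suc n)
    ≡⟨ cong₂ _+_ (sumTo-+ n _ _) (cong (f (suc n)) (+-identityʳ (suc n))) ⟨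
  sumTo n (λ i → sumTo (n ∸ i) (λ j → f i (i + j)) + f i (suc n)) + f (suc n) (suc n + 0)
    ≡⟨ cong₂ _+_ (sumTo-cong n extend) (cong (λ k → sumTo k (λ j → f (suc n) (suc n + j))) (n∸n≡0 n)) ⟨
  sumTo (suc n) (λ i → sumTo (suc n ∸ i) (λ j → f i (i + j)))
    ∎
  where
  inner : ℕ → ℕ
  inner m = sumTo m (λ i → sumTo (m ∸ i) (λ j → f i (i + j)))
  extend : ∀ i → i ≤ n → sumTo (suc n ∸ i) (λ j → f i (i + j))
                       ≡ sumTo (n ∸ i) (λ j → f i (i + j)) + f i (suc n)
  extend i i≤n rewrite +-∸-assoc 1 i≤n =
    cong (λ k → sumTo (n ∸ i) (λ j → f i (i + j)) + f i k)
         (trans (+-suc i (n ∸ i)) (cong suc (m+[n∸m]≡n i≤n)))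

evens odds : (ℕ → ℕ) → ℕ → ℕ
evens f i = f (2 * i)
odds  f i = f (suc (2 * i))

evens-suc : ∀ f i → evens f (suc i) ≡ f (suc (suc (2 * i)))
evens-suc f i = cong f (*-suc 2 i)

sumTo-parity : ∀ n f → sumTo (suc (2 * n)) f ≡ sumTo n (evens f) + sumTo n (odds f)
sumTo-parity zero    f = refl
sumTo-parity (suc n) f = begin
  sumTo (suc (2 * suc n)) f
    ≡⟨ cong (λ m → sumTo (suc m) f) (*-suc 2 n) ⟩
  sumTo (suc (2 * n)) f + f (2 + 2 * n) + f (3 + 2 * n)
    ≡⟨ cong (λ s → s + f (2 + 2 * n) + f (3 + 2 * n)) (sumTo-parity n f) ⟩
  sumTo n (evens f) + sumTo n (odds f) + f (2 + 2 * n) + f (3 + 2 * n)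
    ≡⟨ +-assoc (sumTo n (evens f) + sumTo n (odds f)) _ _ ⟩
  sumTo n (evens f) + sumTo n (odds f) + (f (2 + 2 * n) + f (3 + 2 * n))
    ≡⟨ +-interchange (sumTo n (evens f)) _ _ _ ⟩
  (sumTo n (evens f) + f (2 + 2 * n)) + (sumTo n (odds f) + f (3 + 2 * n))
    ≡⟨ cong₂ (λ a b → (sumTo n (evens f) + a) + (sumTo n (odds f) + b))
             (evens-suc f n) (cong (λ m → f (suc m)) (*-suc 2 n)) ⟨
  sumTo (suc n) (evens f) + sumTo (suc n) (odds f)
    ∎

infixl 7 _⋆_
_⋆_ : (ℕ → ℕ) → (ℕ → ℕ) → ℕ → ℕ
(f ⋆ g) n = sumTo n (λ i → f i * g (n ∸ i))

⋆-unfoldˡ : ∀ f g n → (f ⋆ g) (suc n) ≡ f 0 * g (suc n) + ((λ i → f (suc i)) ⋆ g) n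
⋆-unfoldˡ f g n = sumTo-unfoldˡ n (λ i → f i * g (suc n ∸ i))

⋆-cong : ∀ {f f′ g g′} → (∀ i → f i ≡ f′ i) → (∀ i → g i ≡ g′ i) →
         ∀ n → (f ⋆ g) n ≡ (f′ ⋆ g′) n
⋆-cong f≗f′ g≗g′ n = sumTo-cong n (λ i _ → cong₂ _*_ (f≗f′ i) (g≗g′ (n ∸ i)))

⋆-congˡ : ∀ {f f′} g → (∀ i → f i ≡ f′ i) → ∀ n → (f ⋆ g) n ≡ (f′ ⋆ g) n
⋆-congˡ g f≗f′ n = sumTo-cong n (λ i _ → cong (_* g (n ∸ i)) (f≗f′ i))

⋆-congʳ : ∀ f {g g′} n → (∀ i → i ≤ n → g i ≡ g′ i) → (f ⋆ g) n ≡ (f ⋆ g′) n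
⋆-congʳ f n g≗g′ = sumTo-cong n (λ i _ → cong (f i *_) (g≗g′ (n ∸ i) (m∸n≤m n i)))

⋆-comm : ∀ f g n → (f ⋆ g) n ≡ (g ⋆ f) n
⋆-comm f g n = trans (sumTo-reverse n _) (sumTo-cong n (λ i i≤n →
  trans (cong (λ k → f (n ∸ i) * g k) (m∸[m∸n]≡n i≤n)) (*-comm (f (n ∸ i)) (g i))))

⋆-distribʳ-+ : ∀ f f′ g n → ((λ i → f i + f′ i) ⋆ g) n ≡ (f ⋆ g) n + (f′ ⋆ g) n
⋆-distribʳ-+ f f′ g n =
  trans (sumTo-cong n (λ i _ → *-distribʳ-+ (g (n ∸ i)) (f i) (f′ i))) (sumTo-+ n _ _)

⋆-*ˡ : ∀ c f g n → ((λ i → c * f i) ⋆ g) n ≡ c * (f ⋆ g) n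
⋆-*ˡ c f g n = trans (sumTo-cong n (λ i _ → *-assoc c (f i) (g (n ∸ i)))) (sumTo-* n c _)

⋆-*ʳ : ∀ c f g n → (f ⋆ (λ i → c * g i)) n ≡ c * (f ⋆ g) n
⋆-*ʳ c f g n = trans (⋆-comm f (λ i → c * g i) n) (trans (⋆-*ˡ c g f n) (cong (c *_) (⋆-comm g f n)))

⋆-assoc : ∀ f g h n → ((f ⋆ g) ⋆ h) n ≡ (f ⋆ (g ⋆ h)) n
⋆-assoc f g h n = begin
  sumTo n (λ k → sumTo k (λ i → f i * g (k ∸ i)) * h (n ∸ k))
    ≡⟨ sumTo-cong n (λ k _ → trans (*-comm _ (h (n ∸ k)))
         (trans (sym (sumTo-* k (h (n ∸ k)) _)) (sumTo-cong k (λ i _ → *-comm (h (n ∸ k)) _)))) ⟩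
  sumTo n (λ k → sumTo k (λ i → f i * g (k ∸ i) * h (n ∸ k)))
    ≡⟨ sumTo-exchange n (λ i k → f i * g (k ∸ i) * h (n ∸ k)) ⟩
  sumTo n (λ i → sumTo (n ∸ i) (λ j → f i * g (i + j ∸ i) * h (n ∸ (i + j))))
    ≡⟨ sumTo-cong n (λ i _ → trans
         (sumTo-cong (n ∸ i) (λ j _ → trans
           (cong₂ (λ u v → f i * g u * h v) (m+n∸m≡n i j) (sym (∸-+-assoc n i j)))
           (*-assoc (f i) _ _)))
         (sumTo-* (n ∸ i) (f i) _)) ⟩
  sumTo n (λ i → f i * sumTo (n ∸ i) (λ j → g j * h (n ∸ i ∸ j)))
    ∎

⋆-odd : ∀ f g k → (f ⋆ g) (suc (2 * k)) ≡ (evens f ⋆ odds g) k + (odds f ⋆ evens g) k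
⋆-odd f g k = trans (sumTo-parity k _) (cong₂ _+_ (sumTo-cong k even-term) (sumTo-cong k odd-term))
  where
  even-term : ∀ i → i ≤ k → f (2 * i) * g (suc (2 * k) ∸ 2 * i) ≡ f (2 * i) * g (suc (2 * (k ∸ i)))
  even-term i i≤k = cong (λ m → f (2 * i) * g m)
    (trans (+-∸-assoc 1 (*-monoʳ-≤ 2 i≤k)) (cong suc (sym (*-distribˡ-∸ 2 k i))))
  odd-term : ∀ i → i ≤ k → f (suc (2 * i)) * g (2 * k ∸ 2 * i) ≡ f (suc (2 * i)) * g (2 * (k ∸ i))
  odd-term i _ = cong (λ m → f (suc (2 * i)) * g m) (sym (*-distribˡ-∸ 2 k i))

⋆-even : ∀ f g k → (f ⋆ g) (suc (suc (2 * k))) ≡ (evens f ⋆ evens g) (suc k) + (odds f ⋆ odds g) k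
⋆-even f g k = begin
  (f ⋆ g) (suc (suc (2 * k)))
    ≡⟨ ⋆-unfoldˡ f g (suc (2 * k)) ⟩
  f 0 * g (2 + 2 * k) + ((λ i → f (suc i)) ⋆ g) (suc (2 * k))
    ≡⟨ cong (f 0 * g (2 + 2 * k) +_) (⋆-odd (λ i → f (suc i)) g k) ⟩
  f 0 * g (2 + 2 * k) + ((odds f ⋆ odds g) k + (odds (λ i → f (suc i)) ⋆ evens g) k)
    ≡⟨ cong (f 0 * g (2 + 2 * k) +_) (+-comm ((odds f ⋆ odds g) k) _) ⟩
  f 0 * g (2 + 2 * k) + ((odds (λ i → f (suc i)) ⋆ evens g) k + (odds f ⋆ odds g) k)
    ≡⟨ +-assoc (f 0 * g (2 + 2 * k)) _ ((odds f ⋆ odds g) k) ⟨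
  f 0 * g (2 + 2 * k) + (odds (λ i → f (suc i)) ⋆ evens g) k + (odds f ⋆ odds g) k
    ≡⟨ cong (_+ (odds f ⋆ odds g) k) (trans (⋆-unfoldˡ (evens f) (evens g) k)
         (cong₂ _+_ (cong (f 0 *_) (evens-suc g k)) (⋆-congˡ (evens g) (evens-suc f) k))) ⟨
  (evens f ⋆ evens g) (suc k) + (odds f ⋆ odds g) k
    ∎

⋆-recurrence-unique : ∀ (a d f g : ℕ → ℕ) → f 0 ≡ g 0 →
  (∀ m → f (suc m) ≡ d (suc m) + (a ⋆ f) m) →
  (∀ m → g (suc m) ≡ d (suc m) + (a ⋆ g) m) →
  ∀ n → f n ≡ g n
⋆-recurrence-unique a d f g f₀≡g₀ f-suc g-suc n = agree n n ≤-refl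
  where
  agree : ∀ n j → j ≤ n → f j ≡ g j
  agree _       zero    _         = f₀≡g₀
  agree zero    (suc j) ()
  agree (suc n) (suc j) (s≤s j≤n) = begin
    f (suc j)                ≡⟨ f-suc j ⟩
    d (suc j) + (a ⋆ f) j    ≡⟨ cong (d (suc j) +_) (⋆-congʳ a j agree-below) ⟩
    d (suc j) + (a ⋆ g) j    ≡⟨ g-suc j ⟨
    g (suc j)                ∎
    where
    agree-below : ∀ i → i ≤ j → f i ≡ g i
    agree-below i i≤j = agree n i (≤-trans i≤j j≤n)

-- p = 1 / (1 − x a), hence p d solves t = d + x a t.
⋆-solves-recurrence : ∀ (p a : ℕ → ℕ) → p 0 ≡ 1 → (∀ k → p (suc k) ≡ (a ⋆ p) k) →
  ∀ d m → (p ⋆ d) (suc m) ≡ d (suc m) + (a ⋆ (p ⋆ d)) m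
⋆-solves-recurrence p a p₀≡1 p-suc d m = begin
  (p ⋆ d) (suc m)
    ≡⟨ ⋆-unfoldˡ p d m ⟩
  p 0 * d (suc m) + ((λ i → p (suc i)) ⋆ d) m
    ≡⟨ cong₂ _+_ (cong (_* d (suc m)) p₀≡1) (⋆-congˡ d p-suc m) ⟩
  1 * d (suc m) + ((a ⋆ p) ⋆ d) m
    ≡⟨ cong₂ _+_ (*-identityˡ (d (suc m))) (⋆-assoc a p d m) ⟩
  d (suc m) + (a ⋆ (p ⋆ d)) m ∎

-- ballot m r = r/(2m + r) · C(2m + r, m) for m + r > 0, and ballot 0 0 = 1.
ballot : ℕ → ℕ → ℕ
ballot zero    r       = 1
ballot (suc m) zero    = 0
ballot (suc m) (suc r) = ballot (suc m) r + ballot m (suc (suc r))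

module BallotConvolution (K : ℕ → ℕ → ℕ)
  (K-zero : ∀ r → K 0 (suc r) ≡ K 0 r)
  (K-suc : ∀ m r → K (suc m) (suc r) ≡ K (suc m) r + K m (suc (suc r))) where

  K-zero-const : ∀ r → K 0 r ≡ K 0 0
  K-zero-const zero    = refl
  K-zero-const (suc r) = trans (K-zero r) (K-zero-const r)

  column : ℕ → ℕ → ℕ
  column r i = ballot i r

  K-column : ℕ → ℕ → ℕ
  K-column s i = K i s

  ballot⋆K : ∀ m r s → (column r ⋆ K-column s) m ≡ K m (r + s)
  ballot⋆K zero    r       s =
    trans (+-identityʳ (K 0 s)) (trans (K-zero-const s) (sym (K-zero-const (r + s))))
  ballot⋆K (suc m) zero    s = begin
    (column 0 ⋆ K-column s) (suc m)
      ≡⟨ ⋆-unfoldˡ (column 0) (K-column s) m ⟩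
    1 * K (suc m) s + ((λ i → 0 * column 0 i) ⋆ K-column s) m
      ≡⟨ cong₂ _+_ (*-identityˡ _) (⋆-*ˡ 0 (column 0) (K-column s) m) ⟩
    K (suc m) s + 0
      ≡⟨ +-identityʳ _ ⟩
    K (suc m) s ∎
  ballot⋆K (suc m) (suc r) s = begin
    (column (suc r) ⋆ K-column s) (suc m)
      ≡⟨ ⋆-unfoldˡ (column (suc r)) (K-column s) m ⟩
    1 * K (suc m) s + ((λ i → ballot (suc i) r + column (2 + r) i) ⋆ K-column s) m
      ≡⟨ cong (1 * K (suc m) s +_) (⋆-distribʳ-+ (λ i → ballot (suc i) r) (column (2 + r)) (K-column s) m) ⟩
    1 * K (suc m) s + (((λ i → ballot (suc i) r) ⋆ K-column s) m + (column (2 + r) ⋆ K-column s) m)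
      ≡⟨ +-assoc (1 * K (suc m) s) _ _ ⟨
    1 * K (suc m) s + ((λ i → ballot (suc i) r) ⋆ K-column s) m + (column (2 + r) ⋆ K-column s) m
      ≡⟨ cong (_+ (column (2 + r) ⋆ K-column s) m) (⋆-unfoldˡ (column r) (K-column s) m) ⟨
    (column r ⋆ K-column s) (suc m) + (column (2 + r) ⋆ K-column s) m
      ≡⟨ cong₂ _+_ (ballot⋆K (suc m) r s) (ballot⋆K m (2 + r) s) ⟩
    K (suc m) (r + s) + K m (2 + r + s)
      ≡⟨ K-suc m (r + s) ⟨
    K (suc m) (suc r + s) ∎

shiftedB : ℕ → ℕ → ℕ
shiftedB m r = (2 * m + r) C m

shiftedB-pred : ℕ → ℕ → ℕ
shiftedB-pred zero    r = 0
shiftedB-pred (suc m) r = shiftedB m (suc (suc r))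

B≡shiftedB : ∀ m → B m ≡ shiftedB m 0
B≡shiftedB m = cong (_C m) (sym (+-identityʳ (2 * m)))

shiftedB-suc : ∀ m r → shiftedB (suc m) (suc r) ≡ shiftedB (suc m) r + shiftedB m (suc (suc r))
shiftedB-suc m r = begin
  (2 * suc m + suc r) C suc m  ≡⟨ cong (_C suc m) (+-suc (2 * suc m) r) ⟩
  suc n C suc m                ≡⟨ nCk+nC[k+1]≡[n+1]C[k+1] n m ⟨
  n C m + n C suc m            ≡⟨ +-comm (n C m) _ ⟩
  n C suc m + n C m            ≡⟨ cong (λ k → n C suc m + k C m) (shift m r) ⟩
  n C suc m + shiftedB m (suc (suc r)) ∎
  where
  n = 2 * suc m + r
  shift : ∀ m r → 2 * suc m + r ≡ 2 * m + suc (suc r)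
  shift = solve-∀

[1+2m]C[1+m]≡[1+2m]Cm : ∀ m → suc (2 * m) C suc m ≡ suc (2 * m) C m
[1+2m]C[1+m]≡[1+2m]Cm m = trans (nCk≡nC[n∸k] (s≤s (m≤m+n m (1 * m))))
  (cong (suc (2 * m) C_) (trans (m+n∸m≡n m (1 * m)) (*-identityˡ m)))

shiftedB-suc-zero : ∀ m → shiftedB (suc m) 0 ≡ shiftedB m 1 + shiftedB m 1
shiftedB-suc-zero m = begin
  (2 * suc m + 0) C suc m       ≡⟨ cong (_C suc m) (two-more m) ⟩
  suc n C suc m                 ≡⟨ nCk+nC[k+1]≡[n+1]C[k+1] n m ⟨
  n C m + n C suc m             ≡⟨ cong (n C m +_) ([1+2m]C[1+m]≡[1+2m]Cm m) ⟩
  n C m + n C m                 ≡⟨ cong (λ k → k C m + k C m) (+-comm 1 (2 * m)) ⟩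
  shiftedB m 1 + shiftedB m 1   ∎
  where
  n = suc (2 * m)
  two-more : ∀ m → 2 * suc m + 0 ≡ suc (suc (2 * m))
  two-more = solve-∀

shiftedB-pascal : ∀ m r → shiftedB-pred m r + shiftedB m r ≡ shiftedB m (suc r)
shiftedB-pascal zero    r = refl
shiftedB-pascal (suc m) r = trans (+-comm (shiftedB m (suc (suc r))) _) (sym (shiftedB-suc m r))

ballot≡shiftedB∸shiftedB-pred : ∀ m r → ballot m (suc r) + shiftedB-pred m r ≡ shiftedB m r
ballot≡shiftedB∸shiftedB-pred zero    r       = refl
ballot≡shiftedB∸shiftedB-pred (suc m) zero    = begin
  ballot m 2 + shiftedB m 2                         ≡⟨ cong (ballot m 2 +_) (shiftedB-pascal m 1) ⟨
  ballot m 2 + (shiftedB-pred m 1 + shiftedB m 1)   ≡⟨ +-assoc (ballot m 2) _ _ ⟨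
  ballot m 2 + shiftedB-pred m 1 + shiftedB m 1     ≡⟨ cong (_+ shiftedB m 1) (ballot≡shiftedB∸shiftedB-pred m 1) ⟩
  shiftedB m 1 + shiftedB m 1                       ≡⟨ shiftedB-suc-zero m ⟨
  shiftedB (suc m) 0                                ∎
ballot≡shiftedB∸shiftedB-pred (suc m) (suc r) = begin
  ballot (suc m) (suc r) + ballot m (3 + r) + shiftedB m (3 + r)
    ≡⟨ cong (ballot (suc m) (suc r) + ballot m (3 + r) +_) (shiftedB-pascal m (2 + r)) ⟨
  ballot (suc m) (suc r) + ballot m (3 + r) + (shiftedB-pred m (2 + r) + shiftedB m (2 + r))
    ≡⟨ regroup (ballot (suc m) (suc r)) _ _ _ ⟩
  (ballot (suc m) (suc r) + shiftedB m (2 + r)) + (ballot m (3 + r) + shiftedB-pred m (2 + r))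
    ≡⟨ cong₂ _+_ (ballot≡shiftedB∸shiftedB-pred (suc m) r) (ballot≡shiftedB∸shiftedB-pred m (2 + r)) ⟩
  shiftedB (suc m) r + shiftedB m (2 + r)
    ≡⟨ shiftedB-suc m r ⟨
  shiftedB (suc m) (suc r)
    ∎
  where
  regroup : ∀ a b c d → (a + b) + (c + d) ≡ (a + d) + (b + c)
  regroup = solve-∀

[1+k]*[1+n]C[1+k]≡[1+n]*nCk : ∀ n k → suc k * (suc n C suc k) ≡ suc n * (n C k)
[1+k]*[1+n]C[1+k]≡[1+n]*nCk zero    zero    = refl
[1+k]*[1+n]C[1+k]≡[1+n]*nCk zero    (suc k) =
  trans (cong (suc (suc k) *_) (k>n⇒nCk≡0 (s≤s (s≤s (z≤n {k}))))) (*-zeroʳ (suc (suc k)))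
[1+k]*[1+n]C[1+k]≡[1+n]*nCk (suc n) zero    =
  trans (+-identityʳ _) (trans (nC1≡n (suc (suc n))) (sym (*-identityʳ (suc (suc n)))))
[1+k]*[1+n]C[1+k]≡[1+n]*nCk (suc n) (suc k) = begin
  suc (suc k) * (suc (suc n) C suc (suc k))
    ≡⟨ cong (suc (suc k) *_) (nCk+nC[k+1]≡[n+1]C[k+1] (suc n) (suc k)) ⟨
  suc (suc k) * (a + b)
    ≡⟨ expand a b k ⟩
  a + suc k * a + suc (suc k) * b
    ≡⟨ cong₂ (λ u v → a + u + v) ([1+k]*[1+n]C[1+k]≡[1+n]*nCk n k)
                                  ([1+k]*[1+n]C[1+k]≡[1+n]*nCk n (suc k)) ⟩
  a + suc n * (n C k) + suc n * (n C suc k)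
    ≡⟨ +-assoc a _ _ ⟩
  a + (suc n * (n C k) + suc n * (n C suc k))
    ≡⟨ cong (a +_) (trans (sym (*-distribˡ-+ (suc n) (n C k) (n C suc k)))
                           (cong (suc n *_) (nCk+nC[k+1]≡[n+1]C[k+1] n k))) ⟩
  a + suc n * a
    ∎
  where
  a = suc n C suc k
  b = suc n C suc (suc k)
  expand : ∀ a b k → suc (suc k) * (a + b) ≡ a + suc k * a + suc (suc k) * b
  expand = solve-∀

[1+k]*nC[1+k]≡[n∸k]*nCk : ∀ m k → suc k * ((suc m + k) C suc k) ≡ suc m * ((suc m + k) C k)
[1+k]*nC[1+k]≡[n∸k]*nCk m k = +-cancelˡ-≡ (suc k * a) _ _ (begin
  suc k * a + suc k * b    ≡⟨ *-distribˡ-+ (suc k) a b ⟨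
  suc k * (a + b)          ≡⟨ cong (suc k *_) (nCk+nC[k+1]≡[n+1]C[k+1] n k) ⟩
  suc k * (suc n C suc k)  ≡⟨ [1+k]*[1+n]C[1+k]≡[1+n]*nCk n k ⟩
  suc n * a                ≡⟨ cong (λ l → suc l * a) (+-comm (suc m) k) ⟩
  (suc k + suc m) * a      ≡⟨ *-distribʳ-+ a (suc k) (suc m) ⟩
  suc k * a + suc m * a    ∎)
  where
  n = suc m + k
  a = n C k
  b = n C suc k

ballot*[1+m]≡B : ∀ m → ballot m 1 * suc m ≡ B m
ballot*[1+m]≡B zero    = refl
ballot*[1+m]≡B (suc j) = +-cancelˡ-≡ (y * suc (suc j)) _ _ (begin
  y * suc (suc j) + c * suc (suc j)  ≡⟨ *-distribʳ-+ (suc (suc j)) y c ⟨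
  (y + c) * suc (suc j)              ≡⟨ cong (_* suc (suc j)) (trans (+-comm y c) c+y≡b) ⟩
  b * suc (suc j)                    ≡⟨ *-comm b (suc (suc j)) ⟩
  b + suc j * b                      ≡⟨ cong (b +_) ratio ⟩
  b + suc (suc j) * y                ≡⟨ +-comm b _ ⟩
  suc (suc j) * y + b                ≡⟨ cong (_+ b) (*-comm (suc (suc j)) y) ⟩
  y * suc (suc j) + b                ∎)
  where
  c = ballot (suc j) 1
  y = shiftedB j 2
  b = B (suc j)
  c+y≡b : c + y ≡ b
  c+y≡b = trans (ballot≡shiftedB∸shiftedB-pred (suc j) 0) (sym (B≡shiftedB (suc j)))
  size : ∀ j → suc (suc j) + j ≡ 2 * suc j
  size = solve-∀
  size′ : ∀ j → suc (suc j) + j ≡ 2 * j + 2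
  size′ = solve-∀
  ratio : suc j * b ≡ suc (suc j) * y
  ratio = begin
    suc j * b                                      ≡⟨ cong (λ n → suc j * (n C suc j)) (size j) ⟨
    suc j * ((suc (suc j) + j) C suc j)            ≡⟨ [1+k]*nC[1+k]≡[n∸k]*nCk (suc j) j ⟩
    suc (suc j) * ((suc (suc j) + j) C j)          ≡⟨ cong (λ n → suc (suc j) * (n C j)) (size′ j) ⟩
    suc (suc j) * y                                ∎

Cat≡ballot : ∀ m → Cat m ≡ ballot m 1
Cat≡ballot m = trans (cong (_/ suc m) (sym (ballot*[1+m]≡B m))) (m*n/n≡m (ballot m 1) (suc m))

Cat-suc : ∀ m → Cat (suc m) ≡ (Cat ⋆ Cat) m
Cat-suc m = begin
  Cat (suc m)
    ≡⟨ Cat≡ballot (suc m) ⟩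
  ballot m 2
    ≡⟨ BallotConvolution.ballot⋆K ballot (λ _ → refl) (λ _ _ → refl) m 1 1 ⟨
  ((λ i → ballot i 1) ⋆ (λ i → ballot i 1)) m
    ≡⟨ ⋆-cong Cat≡ballot Cat≡ballot m ⟨
  (Cat ⋆ Cat) m ∎

B-suc : ∀ m → B (suc m) ≡ 2 * (Cat ⋆ B) m
B-suc m = begin
  B (suc m)
    ≡⟨ B≡shiftedB (suc m) ⟩
  shiftedB (suc m) 0
    ≡⟨ shiftedB-suc-zero m ⟩
  shiftedB m 1 + shiftedB m 1
    ≡⟨ cong (λ x → x + x) (BallotConvolution.ballot⋆K shiftedB (λ _ → refl) shiftedB-suc m 1 0) ⟨
  s + s
    ≡⟨ cong (λ x → x + x) (⋆-cong (λ i → sym (Cat≡ballot i)) (λ i → sym (B≡shiftedB i)) m) ⟩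
  (Cat ⋆ B) m + (Cat ⋆ B) m
    ≡⟨ cong ((Cat ⋆ B) m +_) (+-identityʳ _) ⟨
  2 * (Cat ⋆ B) m ∎
  where
  s = ((λ i → ballot i 1) ⋆ (λ i → shiftedB i 0)) m

evens-Cat-suc : ∀ k → evens Cat (suc k) ≡ ((λ i → 2 * odds Cat i) ⋆ evens Cat) k
evens-Cat-suc k = begin
  evens Cat (suc k)
    ≡⟨ evens-suc Cat k ⟩
  Cat (suc (suc (2 * k)))
    ≡⟨ Cat-suc (suc (2 * k)) ⟩
  (Cat ⋆ Cat) (suc (2 * k))
    ≡⟨ ⋆-odd Cat Cat k ⟩
  (evens Cat ⋆ odds Cat) k + (odds Cat ⋆ evens Cat) k
    ≡⟨ cong (_+ (odds Cat ⋆ evens Cat) k) (⋆-comm (evens Cat) (odds Cat) k) ⟩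
  s + s
    ≡⟨ cong (s +_) (+-identityʳ s) ⟨
  2 * s
    ≡⟨ ⋆-*ˡ 2 (odds Cat) (evens Cat) k ⟨
  ((λ i → 2 * odds Cat i) ⋆ evens Cat) k ∎
  where
  s = (odds Cat ⋆ evens Cat) k

odds-B-suc : ∀ m →
  odds B (suc m) ≡ 2 * (evens Cat ⋆ evens B) (suc m) + ((λ i → 2 * odds Cat i) ⋆ odds B) m
odds-B-suc m = begin
  B (suc (2 * suc m))
    ≡⟨ B-suc (2 * suc m) ⟩
  2 * (Cat ⋆ B) (2 * suc m)
    ≡⟨ cong (λ n → 2 * (Cat ⋆ B) n) (*-suc 2 m) ⟩
  2 * (Cat ⋆ B) (suc (suc (2 * m)))
    ≡⟨ cong (2 *_) (⋆-even Cat B m) ⟩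
  2 * ((evens Cat ⋆ evens B) (suc m) + (odds Cat ⋆ odds B) m)
    ≡⟨ *-distribˡ-+ 2 ((evens Cat ⋆ evens B) (suc m)) ((odds Cat ⋆ odds B) m) ⟩
  2 * (evens Cat ⋆ evens B) (suc m) + 2 * (odds Cat ⋆ odds B) m
    ≡⟨ cong (2 * (evens Cat ⋆ evens B) (suc m) +_) (⋆-*ˡ 2 (odds Cat) (odds B) m) ⟨
  2 * (evens Cat ⋆ evens B) (suc m) + ((λ i → 2 * odds Cat i) ⋆ odds B) m ∎

tripleSum≡⋆ : ∀ n → tripleSum n ≡ (evens Cat ⋆ (evens Cat ⋆ evens B)) n
tripleSum≡⋆ n = sumTo-cong n (λ i _ → trans
  (sumTo-cong (n ∸ i) (λ j _ → *-assoc (Cat (2 * i)) (Cat (2 * j)) (B (2 * (n ∸ i ∸ j)))))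
  (sumTo-* (n ∸ i) (Cat (2 * i)) _))

lemma4 : (n : ℕ) → 2 * tripleSum n ≡ B (2 * n + 1)
lemma4 n = begin
  2 * tripleSum n
    ≡⟨ cong (2 *_) (tripleSum≡⋆ n) ⟩
  2 * (evens Cat ⋆ (evens Cat ⋆ evens B)) n
    ≡⟨ ⋆-*ʳ 2 (evens Cat) (evens Cat ⋆ evens B) n ⟨
  (evens Cat ⋆ d) n
    ≡⟨ ⋆-recurrence-unique a d (evens Cat ⋆ d) (odds B) refl
         (⋆-solves-recurrence (evens Cat) a refl evens-Cat-suc d) odds-B-suc n ⟩
  odds B n
    ≡⟨ cong B (+-comm 1 (2 * n)) ⟩
  B (2 * n + 1) ∎
  where
  a d : ℕ → ℕ
  a i = 2 * odds Cat i
  d k = 2 * (evens Cat ⋆ evens B) k
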